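{- Let $X=\prod_{i=1}^n\{0,\dots,m_i\}$, $f\colon X\to X$, and let $f^b=\beta\circ f\circ\beta^{ -1}\colon\mathcal{A}\to\mathcal{A}$ be its partial Boolean conversion. Let $x\in X$. If the local interaction graph $G_f(x)$ contains an edge from $j$ to $i$ with sign $s$ and variation $s_1$, then the local interaction graph $G_{f^b}(\beta(x))$ contains, for every integer $k'$ with $\min\{f_i(x),f_i(x+s_1e^j)\}<k'\le\max\{f_i(x),f_i(x+s_1e^j)\}$, an edge with sign $s$ from the vertex $(j,\,x_j+\tfrac{s_1+1}{2})$ to the vertex $(i,k')$.
   Context: $X_i=\{0,\dots,m_i\}$ with $m_i\ge1$, $m=\sum_i m_i$; coordinates of $\{0,1\}^m$ are indexed by $I=\{(i,j)\mid 1\le i\le n,\,1\le j\le m_i\}$. $\beta\colon X\to\{0,1\}^m$ is given by $\beta_{i,j}(x)=1$ iff $x_i\ge j$; $\mathcal{A}=\beta(X)$. $e^k$ denotes the $k$-th unit vector, $\mathrm{sign}(0)=0$. For a map $g\colon Y\to Y$ where $Y$ is a set of integer vectors with coordinates indexed by a finite set $J$, the local interaction graph $G_g(x)$ at $x\in Y$ is the labelled directed graph with vertex set $J$ having an edge from $j$ to $i$ with sign $s=s_1\,\mathrm{sign}(g_i(x+s_1e^j)-g_i(x))$ whenever $s_1\in\{ -1,1\}$, $x+s_1e^j\in Y$ and $s\ne0$; $s_1$ is called the variation of the edge. (For $f$, $J=\{1,\dots,n\}$, $Y=X$; for $f^b$, $J=I$, $Y=\mathcal{A}$.) -}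

module Defs where

open import Data.Nat as ℕ using (ℕ; zero; suc; _≤ᵇ_)
open import Data.Fin using (Fin; toℕ)
open import Data.Integer using (ℤ; +_; -[1+_]; +[1+_]; _+_; _-_; _*_; 0ℤ; 1ℤ; -1ℤ)
open import Data.Product using (Σ; _×_; _,_; proj₁; proj₂)
open import Data.Sum using (_⊎_)
open import Data.Bool using (if_then_else_)
open import Relation.Binary.PropositionalEquality using (_≡_; _≢_; refl)

sgn : ℤ → ℤ
sgn (+ zero) = 0ℤ
sgn +[1+ _ ] = 1ℤ
sgn -[1+ _ ] = -1ℤ

-- Y is given as a carrier type together with its coordinate map into ℤ^J;
-- g : Y → Y.  EdgeVia … x y … : the edge realised by the neighbour y = x + s₁e^j.
-- EdgeLIG coord g x j i s s₁ : "G_g(x) has an edge j → i with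
-- sign s and variation s₁".
EdgeVia : {J Y : Set} → (coord : Y → J → ℤ) → (g : Y → Y) → (x y : Y) →
          (j i : J) → (s s₁ : ℤ) → Set
EdgeVia coord g x y j i s s₁ =
  (s₁ ≡ 1ℤ ⊎ s₁ ≡ -1ℤ) ×
  (coord y j ≡ coord x j + s₁) ×
  (∀ k → k ≢ j → coord y k ≡ coord x k) ×
  (s ≡ s₁ * sgn (coord (g y) i - coord (g x) i)) ×
  (s ≢ 0ℤ)

EdgeLIG : {J Y : Set} → (coord : Y → J → ℤ) → (g : Y → Y) → Y →
          (j i : J) → (s s₁ : ℤ) → Set
EdgeLIG {J} {Y} coord g x j i s s₁ = Σ Y (λ y → EdgeVia coord g x y j i s s₁)

module _ {n : ℕ} (m : Fin n → ℕ) where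

  X : Set
  X = (i : Fin n) → Fin (suc (m i))

  coordX : X → Fin n → ℤ
  coordX x i = + toℕ (x i)

  -- I = {(i,j) | 1 ≤ j ≤ m i}; the pair (i , j) stands for (i , toℕ j + 1)
  I : Set
  I = Σ (Fin n) (λ i → Fin (m i))

  label : I → Fin n × ℤ
  label (i , j) = i , + suc (toℕ j)

  β : X → I → ℤ
  β x (i , j) = if suc (toℕ j) ≤ᵇ toℕ (x i) then 1ℤ else 0ℤ

  -- 𝒜 = β(X): a Boolean vector together with a preimage under β
  record 𝒜 : Set where
    field
      vec : I → ℤ
      pre : X
      isβ : ∀ k → vec k ≡ β pre k
  open 𝒜 public

  βA : X → 𝒜
  βA x = record { vec = β x ; pre = x ; isβ = λ _ → refl }

  fb : (X → X) → 𝒜 → 𝒜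
  fb f a = βA (f (pre a))

-- β records the value xᵢ in unary, so a unit move of xⱼ flips exactly one bit of β(x), namely
-- (j, xⱼ + 1) when moving up and (j, xⱼ) when moving down. On the output side, the bit (i, k′)
-- of β(f(·)) changes exactly when the value fᵢ(·) crosses the threshold k′, and then in the same
-- direction as fᵢ itself; hence the two edges have the same variation and the same sign.
module Submission where

open import Defs
open import Data.Nat using (ℕ; _≤_)
open import Data.Fin using (Fin; toℕ)
open import Data.Integer using (ℤ; +_; _+_; _<_; _⊓_; _⊔_; _/_; 1ℤ)
open import Data.Integer using () renaming (_≤_ to _≤ℤ_)
open import Data.Product using (Σ; _×_; _,_)
open import Relation.Binary.PropositionalEquality using (_≡_)

import Data.Nat as ℕ
import Data.Nat.Properties as ℕ
import Data.Integer as ℤ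
import Data.Integer.Properties as ℤ
import Data.Fin as Fin
import Data.Fin.Properties as Fin
open import Data.Bool using (true; false; T; if_then_else_)
open import Data.Empty using (⊥-elim)
open import Data.Sum using (_⊎_; inj₁; inj₂)
open import Function using (_∘_)
open import Relation.Nullary using (yes; no)
open import Relation.Binary using (tri<; tri≈; tri>)
open import Relation.Binary.PropositionalEquality
  using (refl; sym; trans; cong; subst; _≢_; module ≡-Reasoning)

threshold : ℕ → ℕ → ℤ
threshold c w = if c ℕ.≤ᵇ w then 1ℤ else ℤ.0ℤ

threshold-≤ : ∀ {c w} → c ℕ.≤ w → threshold c w ≡ 1ℤ
threshold-≤ {c} {w} c≤w with c ℕ.≤ᵇ w | ℕ.≤⇒≤ᵇ c≤w
... | true  | _ = refl

threshold-> : ∀ {c w} → w ℕ.< c → threshold c w ≡ ℤ.0ℤ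
threshold-> {c} {w} w<c with c ℕ.≤ᵇ w in eq
... | false = refl
... | true  = ⊥-elim (ℕ.<⇒≱ w<c (ℕ.≤ᵇ⇒≤ c w (subst T (sym eq) _)))

threshold-suc-self : ∀ p → threshold (ℕ.suc p) (ℕ.suc p) ≡ threshold (ℕ.suc p) p + 1ℤ
threshold-suc-self p rewrite threshold-≤ (ℕ.≤-refl {ℕ.suc p}) | threshold-> (ℕ.n<1+n p) = refl

threshold-suc-other : ∀ {c p} → c ≢ ℕ.suc p → threshold c (ℕ.suc p) ≡ threshold c p
threshold-suc-other {c} {p} c≢1+p with ℕ.<-cmp c (ℕ.suc p)
... | tri< c<1+p _ _ rewrite threshold-≤ (ℕ.<⇒≤ c<1+p) | threshold-≤ (ℕ.s≤s⁻¹ c<1+p) = refl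
... | tri≈ _ c≡1+p _ = ⊥-elim (c≢1+p c≡1+p)
... | tri> _ _ 1+p<c rewrite threshold-> 1+p<c | threshold-> (ℕ.<-trans (ℕ.n<1+n p) 1+p<c) = refl

sgn-⊖-< : ∀ u v → u ℕ.< v → sgn (v ℤ.⊖ u) ≡ 1ℤ
sgn-⊖-< ℕ.zero    (ℕ.suc v) _ = refl
sgn-⊖-< (ℕ.suc u) (ℕ.suc v) (ℕ.s≤s u<v) rewrite ℤ.[1+m]⊖[1+n]≡m⊖n v u = sgn-⊖-< u v u<v

sgn-⊖-> : ∀ u v → v ℕ.< u → sgn (v ℤ.⊖ u) ≡ ℤ.-1ℤ
sgn-⊖-> (ℕ.suc u) ℕ.zero    _ = refl
sgn-⊖-> (ℕ.suc u) (ℕ.suc v) (ℕ.s≤s v<u) rewrite ℤ.[1+m]⊖[1+n]≡m⊖n v u = sgn-⊖-> u v v<u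

sgn-threshold-crossing : ∀ {u v c} → u ℕ.⊓ v ℕ.< c → c ℕ.≤ u ℕ.⊔ v →
                         sgn (threshold c v ℤ.- threshold c u) ≡ sgn (+ v ℤ.- + u)
sgn-threshold-crossing {u} {v} lo hi rewrite ℤ.[+m]-[+n]≡m⊖n v u with ℕ.<-cmp u v
... | tri< u<v _ _
  rewrite ℕ.m≤n⇒m⊓n≡m (ℕ.<⇒≤ u<v) | ℕ.m≤n⇒m⊔n≡n (ℕ.<⇒≤ u<v)
        | threshold-≤ hi | threshold-> lo = sym (sgn-⊖-< u v u<v)
... | tri≈ _ refl _ rewrite ℕ.⊓-idem u | ℕ.⊔-idem u = ⊥-elim (ℕ.<⇒≱ lo hi)
... | tri> _ _ v<u
  rewrite ℕ.m≥n⇒m⊓n≡n (ℕ.<⇒≤ v<u) | ℕ.m≥n⇒m⊔n≡m (ℕ.<⇒≤ v<u)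
        | threshold-≤ hi | threshold-> lo = sym (sgn-⊖-> u v v<u)

threshold-between : ∀ {M} (u v : Fin (ℕ.suc M)) (k′ : ℤ) →
                    + toℕ u ⊓ + toℕ v < k′ → k′ ≤ℤ + toℕ u ⊔ + toℕ v →
                    Σ (Fin M) λ k → (+ ℕ.suc (toℕ k) ≡ k′) ×
                      (toℕ u ℕ.⊓ toℕ v ℕ.< ℕ.suc (toℕ k)) × (ℕ.suc (toℕ k) ≤ toℕ u ℕ.⊔ toℕ v)
threshold-between u v (+ ℕ.zero) (ℤ.+<+ ()) _
threshold-between u v ℤ.-[1+ _ ] () _
threshold-between u v (+ ℕ.suc K) (ℤ.+<+ lo) (ℤ.+≤+ hi) =
  k , cong (+_ ∘ ℕ.suc) k≡K ,
  subst (λ c → _ ℕ.< ℕ.suc c) (sym k≡K) lo , subst (λ c → ℕ.suc c ≤ _) (sym k≡K) hi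
  where
  K<M : K ℕ.< _
  K<M = ℕ.≤-trans hi (ℕ.⊔-lub (Fin.toℕ≤pred[n] u) (Fin.toℕ≤pred[n] v))
  k : Fin _
  k = Fin.fromℕ< K<M
  k≡K : toℕ k ≡ K
  k≡K = Fin.toℕ-fromℕ< K<M

Shift : {J : Set} → J → ℤ → (J → ℤ) → (J → ℤ) → Set
Shift k s u v = (v k ≡ u k + s) × (∀ l → l ≢ k → v l ≡ u l)

Shift-sym : ∀ {J : Set} {k : J} {s u v} → Shift k s u v → Shift k (ℤ.- s) v u
Shift-sym {k = k} {s} {u} {v} (vk≡uk+s , vl≡ul) = uk≡vk-s , λ l l≢k → sym (vl≡ul l l≢k)
  where
  open ≡-Reasoning
  uk≡vk-s : u k ≡ v k + ℤ.- s
  uk≡vk-s = begin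
    u k               ≡⟨ sym (ℤ.+-identityʳ (u k)) ⟩
    u k + ℤ.0ℤ        ≡⟨ cong (λ z → u k + z) (sym (ℤ.+-inverseʳ s)) ⟩
    u k + (s ℤ.- s)   ≡⟨ sym (ℤ.+-assoc (u k) s (ℤ.- s)) ⟩
    u k + s ℤ.- s     ≡⟨ cong (ℤ._- s) (sym vk≡uk+s) ⟩
    v k ℤ.- s         ∎

module _ {n : ℕ} (m : Fin n → ℕ) where

  Shift-coordX-suc : ∀ {x y : X m} {j} → Shift j 1ℤ (coordX m x) (coordX m y) →
                     toℕ (y j) ≡ ℕ.suc (toℕ (x j))
  Shift-coordX-suc {x} {y} {j} (yj≡xj+1 , _) = trans (ℤ.+-injective yj≡xj+1) (ℕ.+-comm (toℕ (x j)) 1)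

  Shift-β-up : ∀ {x y : X m} {j} → Shift j 1ℤ (coordX m x) (coordX m y) →
               Σ (Fin (m j)) λ a → (toℕ a ≡ toℕ (x j)) × Shift (j , a) 1ℤ (β m x) (β m y)
  Shift-β-up {x} {y} {j} shift@(_ , yl≡xl) = a , a≡xj , flipped , unchanged
    where
    yj≡1+xj : toℕ (y j) ≡ ℕ.suc (toℕ (x j))
    yj≡1+xj = Shift-coordX-suc shift
    xj<mj : toℕ (x j) ℕ.< m j
    xj<mj = ℕ.≤-trans (ℕ.≤-reflexive (sym yj≡1+xj)) (Fin.toℕ≤pred[n] (y j))
    a : Fin (m j)
    a = Fin.fromℕ< xj<mj
    a≡xj : toℕ a ≡ toℕ (x j)
    a≡xj = Fin.toℕ-fromℕ< xj<mj

    flipped : β m y (j , a) ≡ β m x (j , a) + 1ℤ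
    flipped rewrite a≡xj | yj≡1+xj = threshold-suc-self (toℕ (x j))

    unchanged : ∀ b → b ≢ (j , a) → β m y b ≡ β m x b
    unchanged (l , c) b≢a with l Fin.≟ j
    ... | yes refl = trans (cong (threshold _) yj≡1+xj) (threshold-suc-other λ c≡xj →
      b≢a (cong (j ,_) (Fin.toℕ-injective (trans (ℕ.suc-injective c≡xj) (sym a≡xj)))))
    ... | no l≢j rewrite ℤ.+-injective (yl≡xl l l≢j) = refl

  -- The flipped bit sits at label xⱼ + 1 for s₁ = 1 and at xⱼ for s₁ = -1, i.e. at xⱼ + (s₁ + 1)/2.
  Shift-β : ∀ {x y : X m} {j} s₁ → s₁ ≡ 1ℤ ⊎ s₁ ≡ ℤ.-1ℤ → Shift j s₁ (coordX m x) (coordX m y) →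
            Σ (Fin (m j)) λ a → (label m (j , a) ≡ (j , + toℕ (x j) + (s₁ + 1ℤ) / + 2)) ×
              Shift (j , a) s₁ (β m x) (β m y)
  Shift-β {x} {y} {j} .1ℤ (inj₁ refl) shift with Shift-β-up shift
  ... | a , a≡xj , β-shift =
    a , cong (λ c → j , + c) (trans (cong ℕ.suc a≡xj) (ℕ.+-comm 1 (toℕ (x j)))) , β-shift
  Shift-β {x} {y} {j} .ℤ.-1ℤ (inj₂ refl) shift with Shift-β-up (Shift-sym {s = ℤ.-1ℤ} shift)
  ... | a , a≡yj , β-shift =
    a , cong (λ c → j , + c) (trans (cong ℕ.suc a≡yj) (trans (sym xj≡1+yj) (sym (ℕ.+-identityʳ _)))) ,
    Shift-sym β-shift
    where
    xj≡1+yj : toℕ (x j) ≡ ℕ.suc (toℕ (y j))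
    xj≡1+yj = Shift-coordX-suc (Shift-sym {s = ℤ.-1ℤ} shift)

lemma1 : (n : ℕ) (m : Fin n → ℕ) → (∀ i → 1 ≤ m i) →
         (f : X m → X m) (x y : X m) (j i : Fin n) (s s₁ : ℤ) →
         EdgeVia (coordX m) f x y j i s s₁ →
         (k′ : ℤ) →
         (coordX m (f x) i ⊓ coordX m (f y) i) < k′ →
         k′ ≤ℤ (coordX m (f x) i ⊔ coordX m (f y) i) →
         Σ (I m) (λ a → Σ (I m) (λ b →
           (label m a ≡ (j , (+ toℕ (x j) + ((s₁ + 1ℤ) / + 2)))) ×
           (label m b ≡ (i , k′)) ×
           Σ ℤ (λ t₁ → EdgeLIG (𝒜.vec {m = m}) (fb m f) (βA m x) a b s t₁)))
lemma1 n m _ f x y j i s s₁ (s₁± , yj≡xj+s₁ , yl≡xl , s≡ , s≢0) k′ lo hi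
  with Shift-β m s₁ s₁± (yj≡xj+s₁ , yl≡xl) | threshold-between (f x i) (f y i) k′ lo hi
... | a , a-label , (βyj≡βxj+s₁ , βyl≡βxl) | k , k-label , k-lo , k-hi =
  (j , a) , (i , k) , a-label , cong (i ,_) k-label , s₁ , βA m y ,
  s₁± , βyj≡βxj+s₁ , βyl≡βxl ,
  trans s≡ (cong (s₁ ℤ.*_) (sym (sgn-threshold-crossing k-lo k-hi))) , s≢0
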